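{- Let $A$, $B$ and $C$ be sets of pairs of strings, let $g,h$ be bounding functions, and suppose that $C$ is open. Suppose that $B$ is $(g,h)$-big above $A$, and that for all $(\tau,\rho)\in B$ and all strings $\tau'\succeq\tau$, $C$ is $(g,h)$-big above $(\tau',\rho)$. Then $C$ is $(g,h)$-big above $A$.
   Context: A bounding function is a computable function $\omega\to[2,\omega)$. Strings are elements of $\omega^{<\omega}$; $\sigma^{\preceq}$ is the set of strings extending $\sigma$, $D^{\preceq}=\bigcup_{\sigma\in D}\sigma^{\preceq}$. A tree above $\sigma$ is a nonempty subset of $\sigma^{\preceq}$ closed under initial segments of length $\ge|\sigma|$; for a finite prefix-free set $D$ of strings, a forest above $D$ is $F\subseteq D^{\preceq}$ with $F\cap\sigma^{\preceq}$ a tree above $\sigma$ for each $\sigma\in D$. Leaves, $h$-bushiness (every non-leaf $\tau$ has at least $h(|\tau|)$ immediate successors), and end-extensions (every new string extends an old leaf) are as usual. For a set $A$ of pairs of strings, $A(\tau)=\{\rho:(\tau,\rho)\in A\}$, $\operatorname{dom}A=\{\tau:A(\tau)\ne\emptyset\}$; $A$ is prefix-free if $\operatorname{dom}A$ and every $A(\tau)$ are prefix-free; $\tau^{ -D}$ is the unique element of a prefix-free $D$ below $\tau$. A forest system above a finite prefix-free set $A$ of pairs is a set $T$ of pairs such that $\operatorname{dom}T$ is a forest above $\operatorname{dom}A$, each $T(\tau)$ is a finite forest above $A(\tau^{ -\operatorname{dom}A})$, and $T(\tau')$ end-extends $T(\tau)$ whenever $\tau\prec\tau'$ are in $\operatorname{dom}T$.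 Its leaves are pairs $(\tau,\rho)$ with $\tau$ a leaf of $\operatorname{dom}T$ and $\rho$ a leaf of $T(\tau)$; it is $(g,h)$-bushy if $\operatorname{dom}T$ is $g$-bushy and each $T(\tau)$ is $h$-bushy. For a finite prefix-free set $A$ of pairs, $B$ is $(g,h)$-big above $A$ if there is a finite $(g,h)$-bushy forest system above $A$ all of whose leaves lie in $B$; for an arbitrary set $A$ of pairs, $B$ is $(g,h)$-big above $A$ if it is $(g,h)$-big above every finite prefix-free subset of $A$; for a single pair use $A=\{(\tau,\rho)\}$. Pairs are ordered by $(\tau,\rho)\preceq(\tau',\rho')$ iff $\tau\preceq\tau'$ and $\rho\preceq\rho'$; a set of pairs is open if it is upward closed in this ordering. -}

module Defs where

open import Data.Nat using (ℕ; _≤_)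
open import Data.List using (List; []; _∷_; _++_; _∷ʳ_; length)
open import Data.List.Membership.Propositional using (_∈_)
open import Data.List.Relation.Unary.All using (All)
open import Data.List.Relation.Unary.Unique.Propositional using (Unique)
open import Data.Product using (Σ; ∃; _×_; _,_)
open import Relation.Binary.PropositionalEquality using (_≡_; _≢_)
open import Relation.Nullary using (¬_)

Str : Set
Str = List ℕ

Pair : Set
Pair = Str × Str

StrSet : Set₁
StrSet = Str → Set

PairSet : Set₁
PairSet = Pair → Set

_⪯_ : Str → Str → Set
σ ⪯ τ = ∃ λ ρ → σ ++ ρ ≡ τ

_≺_ : Str → Str → Set
σ ≺ τ = σ ⪯ τ × σ ≢ τ

-- Bounding function: a function ω → [2, ω).  (Every Agda function is computable.)
IsBounding : (ℕ → ℕ) → Set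
IsBounding g = ∀ n → 2 ≤ g n

PrefixFree : StrSet → Set
PrefixFree D = ∀ σ σ' → D σ → D σ' → σ ⪯ σ' → σ ≡ σ'

IsTreeAbove : StrSet → Str → Set
IsTreeAbove F σ =
  (∃ λ τ → F τ) ×
  (∀ τ → F τ → σ ⪯ τ) ×
  (∀ τ τ' → F τ → τ' ⪯ τ → length σ ≤ length τ' → F τ')

IsForestAbove : StrSet → StrSet → Set
IsForestAbove F D =
  (∀ τ → F τ → ∃ λ σ → D σ × σ ⪯ τ) ×
  (∀ σ → D σ → IsTreeAbove (λ τ → F τ × σ ⪯ τ) σ)

IsLeaf : StrSet → Str → Set
IsLeaf F τ = F τ × (∀ τ' → F τ' → τ ⪯ τ' → τ' ≡ τ)

IsBushy : (ℕ → ℕ) → StrSet → Set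
IsBushy h F = ∀ τ → F τ → ¬ IsLeaf F τ →
  ∃ λ (ns : List ℕ) → Unique ns × h (length τ) ≤ length ns × All (λ n → F (τ ∷ʳ n)) ns

EndExtends : StrSet → StrSet → Set
EndExtends F' F =
  (∀ ρ → F ρ → F' ρ) ×
  (∀ ρ → F' ρ → ¬ F ρ → ∃ λ λ₀ → IsLeaf F λ₀ × λ₀ ⪯ ρ)

dom : PairSet → StrSet
dom A τ = ∃ λ ρ → A (τ , ρ)

section : PairSet → Str → StrSet
section A τ ρ = A (τ , ρ)

PrefixFreePairs : PairSet → Set
PrefixFreePairs A = PrefixFree (dom A) × (∀ τ → PrefixFree (section A τ))

-- Finite sets of pairs are given by lists.
⟦_⟧ : List Pair → PairSet
⟦ L ⟧ p = p ∈ L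

-- T is a forest system above A (T finite, given as a list).
-- For τ ∈ dom T, τ^{-dom A} is the unique σ ∈ dom A with σ ⪯ τ (dom A prefix-free).
IsForestSystem : List Pair → PairSet → Set
IsForestSystem T A =
  IsForestAbove (dom ⟦ T ⟧) (dom A) ×
  (∀ τ σ → dom ⟦ T ⟧ τ → dom A σ → σ ⪯ τ → IsForestAbove (section ⟦ T ⟧ τ) (section A σ)) ×
  (∀ τ τ' → dom ⟦ T ⟧ τ → dom ⟦ T ⟧ τ' → τ ≺ τ' → EndExtends (section ⟦ T ⟧ τ') (section ⟦ T ⟧ τ))

IsSysLeaf : List Pair → Pair → Set
IsSysLeaf T (τ , ρ) = IsLeaf (dom ⟦ T ⟧) τ × IsLeaf (section ⟦ T ⟧ τ) ρ

IsSysBushy : (ℕ → ℕ) → (ℕ → ℕ) → List Pair → Set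
IsSysBushy g h T = IsBushy g (dom ⟦ T ⟧) × (∀ τ → dom ⟦ T ⟧ τ → IsBushy h (section ⟦ T ⟧ τ))

BigFin : (ℕ → ℕ) → (ℕ → ℕ) → PairSet → PairSet → Set
BigFin g h B A = ∃ λ (T : List Pair) →
  IsForestSystem T A × IsSysBushy g h T × (∀ p → IsSysLeaf T p → B p)

Big : (ℕ → ℕ) → (ℕ → ℕ) → PairSet → PairSet → Set
Big g h B A = ∀ (L : List Pair) → (∀ p → p ∈ L → A p) → PrefixFreePairs ⟦ L ⟧ → BigFin g h B ⟦ L ⟧

single : Pair → PairSet
single p q = q ≡ p

_⪯ₚ_ : Pair → Pair → Set
(τ , ρ) ⪯ₚ (τ' , ρ') = τ ⪯ τ' × ρ ⪯ ρ'

IsOpen : PairSet → Set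
IsOpen C = ∀ p q → C p → p ⪯ₚ q → C q

-- Everything rests on one construction, concatenation of forest systems: if T
-- is a bushy forest system above A and, for each leaf τ of dom T, S τ is a
-- bushy forest system above the pairs (τ , ρ) with ρ in a set P τ of leaves
-- of T(τ), then T together with all S τ -- with T(τ) copied onto every node
-- of dom (S τ) -- is a bushy forest system above A.  Its leaves are leaves of
-- some S τ, or pairs (τ' , ρ) with τ ⪯ τ' and ρ a leaf of T(τ) outside P τ.
--
-- Given a finite prefix-free L ⊆ A, take a bushy system T above L with leaves
-- in B.  At a leaf τ of dom T the leaves ρ₁ … ρₖ of T(τ) are handled one at a
-- time: C is big above (τ , ρ₁), and concatenating leaves pairs in C and
-- pairs (τ' , ρᵢ) with τ ⪯ τ', i > 1, where we recurse (the hypothesis is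
-- closed under extending τ, and pairs already in C stay in C by openness).
-- A final concatenation along all leaves of dom T proves the theorem.
module Submission where

open import Defs
open import Data.Nat using (ℕ; _≤_; z≤n; s≤s; _≤?_)
open import Data.Nat.Properties using (≤-refl; ≰⇒≥)
import Data.Nat as ℕ
open import Data.List using (List; []; _∷_; _++_; _∷ʳ_; length; map; concatMap; filter)
import Data.List.Properties as List
open import Data.List.Membership.Propositional using (_∈_; lose; find)
open import Data.List.Membership.Propositional.Properties
  using (∈-map⁺; ∈-map⁻; ∈-filter⁺; ∈-filter⁻; ∈-++⁺ˡ; ∈-++⁺ʳ; ∈-++⁻; ∈-concatMap⁺; ∈-concatMap⁻)
open import Data.List.Relation.Unary.Any using (here; there)
open import Data.List.Relation.Unary.All using (All)
import Data.List.Relation.Unary.All as All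
open import Data.List.Relation.Unary.Unique.Propositional using (Unique)
open import Data.Product using (Σ; ∃; _×_; _,_; proj₁; proj₂)
import Data.Product.Properties as Product
open import Data.Sum using (_⊎_; inj₁; inj₂)
open import Data.Empty using (⊥-elim)
open import Relation.Nullary using (¬_; Dec; yes; no)
open import Relation.Binary.PropositionalEquality using (_≡_; refl; sym; trans; cong; subst)

[]⪯ : ∀ τ → [] ⪯ τ
[]⪯ τ = τ , refl

⪯-refl : ∀ σ → σ ⪯ σ
⪯-refl σ = [] , List.++-identityʳ σ

⪯-trans : ∀ {σ τ υ} → σ ⪯ τ → τ ⪯ υ → σ ⪯ υ
⪯-trans {σ} (ρ , refl) (ρ' , refl) = ρ ++ ρ' , sym (List.++-assoc σ ρ ρ')

∷-⪯-inv : ∀ {x y σ τ} → (x ∷ σ) ⪯ (y ∷ τ) → x ≡ y × σ ⪯ τ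
∷-⪯-inv (ρ , refl) = refl , (ρ , refl)

∷-⪯ : ∀ {σ τ} x → σ ⪯ τ → (x ∷ σ) ⪯ (x ∷ τ)
∷-⪯ x (ρ , eq) = ρ , cong (x ∷_) eq

∷-⋠-[] : ∀ {x σ} → ¬ ((x ∷ σ) ⪯ [])
∷-⋠-[] (ρ , ())

⪯-antisym : ∀ {σ τ} → σ ⪯ τ → τ ⪯ σ → σ ≡ τ
⪯-antisym {[]} {[]} p q = refl
⪯-antisym {[]} {y ∷ τ} p q = ⊥-elim (∷-⋠-[] q)
⪯-antisym {x ∷ σ} {[]} p q = ⊥-elim (∷-⋠-[] p)
⪯-antisym {x ∷ σ} {y ∷ τ} p q with ∷-⪯-inv p | ∷-⪯-inv q
... | refl , p' | _ , q' = cong (x ∷_) (⪯-antisym p' q')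

⪯-length : ∀ {σ τ} → σ ⪯ τ → length σ ≤ length τ
⪯-length {[]} p = z≤n
⪯-length {x ∷ σ} {[]} p = ⊥-elim (∷-⋠-[] p)
⪯-length {x ∷ σ} {y ∷ τ} p = s≤s (⪯-length (proj₂ (∷-⪯-inv p)))

⪯-byLength : ∀ {σ σ' τ} → σ ⪯ τ → σ' ⪯ τ → length σ ≤ length σ' → σ ⪯ σ'
⪯-byLength {[]} p q l = []⪯ _
⪯-byLength {x ∷ σ} {[]} p q ()
⪯-byLength {x ∷ σ} {x' ∷ σ'} {[]} p q l = ⊥-elim (∷-⋠-[] p)
⪯-byLength {x ∷ σ} {x' ∷ σ'} {y ∷ τ} p q (s≤s l) with ∷-⪯-inv p | ∷-⪯-inv q
... | refl , p' | refl , q' = ∷-⪯ x (⪯-byLength p' q' l)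

⪯-comparable : ∀ {σ σ' τ} → σ ⪯ τ → σ' ⪯ τ → σ ⪯ σ' ⊎ σ' ⪯ σ
⪯-comparable {σ} {σ'} p q with length σ ≤? length σ'
... | yes l = inj₁ (⪯-byLength p q l)
... | no l = inj₂ (⪯-byLength q p (≰⇒≥ l))

_⪯?_ : ∀ σ τ → Dec (σ ⪯ τ)
[] ⪯? τ = yes ([]⪯ τ)
(x ∷ σ) ⪯? [] = no ∷-⋠-[]
(x ∷ σ) ⪯? (y ∷ τ) with x ℕ.≟ y | σ ⪯? τ
... | yes refl | yes p = yes (∷-⪯ x p)
... | yes refl | no ¬p = no λ q → ¬p (proj₂ (∷-⪯-inv q))
... | no ¬e | _ = no λ q → ¬e (proj₁ (∷-⪯-inv q))

_≟ₛ_ : (σ τ : Str) → Dec (σ ≡ τ)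
_≟ₛ_ = List.≡-dec ℕ._≟_

_≟ₚ_ : (p q : Pair) → Dec (p ≡ q)
_≟ₚ_ = Product.≡-dec _≟ₛ_ _≟ₛ_

open import Data.List.Membership.DecPropositional _≟ₚ_ using (_∈?_)
import Data.List.Membership.DecPropositional _≟ₛ_ as Strings

-- Forest systems, their bushiness and leaves, for arbitrary sets of pairs.
-- For a list T, ForestSystem ⟦ T ⟧ A is IsForestSystem T A by definition, and
-- likewise for the other two notions.

ForestSystem : PairSet → PairSet → Set
ForestSystem T A =
  IsForestAbove (dom T) (dom A) ×
  (∀ τ σ → dom T τ → dom A σ → σ ⪯ τ → IsForestAbove (section T τ) (section A σ)) ×
  (∀ τ τ' → dom T τ → dom T τ' → τ ≺ τ' → EndExtends (section T τ') (section T τ))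

SystemBushy : (ℕ → ℕ) → (ℕ → ℕ) → PairSet → Set
SystemBushy g h T = IsBushy g (dom T) × (∀ τ → dom T τ → IsBushy h (section T τ))

SystemLeaf : PairSet → Pair → Set
SystemLeaf T (τ , ρ) = IsLeaf (dom T) τ × IsLeaf (section T τ) ρ

BigFin-mono : ∀ {g h Q Q' A} → (∀ p → Q p → Q' p) → BigFin g h Q A → BigFin g h Q' A
BigFin-mono Q⊆Q' (T , system , bushy , leaves) = T , system , bushy , λ p l → Q⊆Q' p (leaves p l)

module _ {F D : StrSet} (forest : IsForestAbove F D) where
  forest-base : ∀ {τ} → F τ → ∃ λ σ → D σ × σ ⪯ τ
  forest-base = proj₁ forest _

  forest-closed : ∀ {σ τ τ'} → D σ → F τ → σ ⪯ τ → τ' ⪯ τ → length σ ≤ length τ' → F τ'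
  forest-closed {σ} dσ fτ στ le ln = proj₁ (proj₂ (proj₂ (proj₂ forest σ dσ)) _ _ (fτ , στ) le ln)

  forest-root : ∀ {σ} → D σ → F σ
  forest-root {σ} dσ with proj₁ (proj₂ forest σ dσ)
  ... | τ , fτ , στ = forest-closed dσ fτ στ στ ≤-refl

module _ {T A : PairSet} (system : ForestSystem T A) where
  system-dom : IsForestAbove (dom T) (dom A)
  system-dom = proj₁ system

  system-section : ∀ {τ σ} → dom T τ → dom A σ → σ ⪯ τ → IsForestAbove (section T τ) (section A σ)
  system-section = proj₁ (proj₂ system) _ _

  system-endExtends : ∀ {τ τ'} → dom T τ → dom T τ' → τ ≺ τ' → EndExtends (section T τ') (section T τ)
  system-endExtends = proj₂ (proj₂ system) _ _

-- Extensional equality of sets.  Every notion of Defs is invariant under it;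
-- this lets us construct systems as predicates and only afterwards represent
-- them by lists.

_≐_ : StrSet → StrSet → Set
F ≐ G = (∀ x → F x → G x) × (∀ x → G x → F x)

≐-sym : ∀ {F G} → F ≐ G → G ≐ F
≐-sym (a , b) = b , a

leaf-≐ : ∀ {F G x} → F ≐ G → IsLeaf F x → IsLeaf G x
leaf-≐ (a , b) (fx , maximal) = a _ fx , λ y gy xy → maximal y (b y gy) xy

forest-≐ : ∀ {F G D} → F ≐ G → IsForestAbove F D → IsForestAbove G D
forest-≐ (a , b) (base , trees) =
  (λ τ gτ → base τ (b τ gτ)) ,
  λ σ dσ → let ((t , ft , st) , above , closed) = trees σ dσ in
    (t , a t ft , st) , (λ τ (gτ , sτ) → above τ (b τ gτ , sτ)) ,
    λ τ τ' (gτ , sτ) le ln → let (x , y) = closed τ τ' (b τ gτ , sτ) le ln in a τ' x , y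

bushy-≐ : ∀ {F G h} → F ≐ G → IsBushy h F → IsBushy h G
bushy-≐ (a , b) bushy τ gτ notLeaf =
  let (ns , unique , enough , succs) = bushy τ (b τ gτ) (λ l → notLeaf (leaf-≐ (a , b) l)) in
  ns , unique , enough , All.map (a _) succs

endExtends-≐ : ∀ {F F' G G'} → F ≐ F' → G ≐ G' → EndExtends G F → EndExtends G' F'
endExtends-≐ (a , b) (c , d) (old , new) =
  (λ ρ f'ρ → c ρ (old ρ (b ρ f'ρ))) ,
  λ ρ g'ρ nf' → let (l , leaf , lρ) = new ρ (d ρ g'ρ) (λ fρ → nf' (a ρ fρ)) in
     l , leaf-≐ (a , b) leaf , lρ

_≐ₚ_ : PairSet → PairSet → Set
X ≐ₚ Y = (∀ p → X p → Y p) × (∀ p → Y p → X p)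

≐ₚ-sym : ∀ {X Y} → X ≐ₚ Y → Y ≐ₚ X
≐ₚ-sym (a , b) = b , a

dom-≐ : ∀ {X Y} → X ≐ₚ Y → dom X ≐ dom Y
dom-≐ (a , b) = (λ τ (ρ , x) → ρ , a _ x) , (λ τ (ρ , y) → ρ , b _ y)

section-≐ : ∀ {X Y} τ → X ≐ₚ Y → section X τ ≐ section Y τ
section-≐ τ (a , b) = (λ ρ → a (τ , ρ)) , (λ ρ → b (τ , ρ))

system-≐ : ∀ {X Y A} → X ≐ₚ Y → ForestSystem X A → ForestSystem Y A
system-≐ e (domForest , sections , endExt) =
  forest-≐ (dom-≐ e) domForest ,
  (λ τ σ dτ dσ le → forest-≐ (section-≐ τ e) (sections τ σ (Y→X τ dτ) dσ le)) ,
  λ τ τ' dτ dτ' lt → endExtends-≐ (section-≐ τ e) (section-≐ τ' e) (endExt τ τ' (Y→X τ dτ) (Y→X τ' dτ') lt)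
  where Y→X = proj₂ (dom-≐ e)

systemBushy-≐ : ∀ {X Y g h} → X ≐ₚ Y → SystemBushy g h X → SystemBushy g h Y
systemBushy-≐ {g = g} {h} e (domBushy , sectionBushy) =
  bushy-≐ {h = g} (dom-≐ e) domBushy ,
  λ τ dτ → bushy-≐ {h = h} (section-≐ τ e) (sectionBushy τ (proj₂ (dom-≐ e) τ dτ))

systemLeaf-≐ : ∀ {X Y p} → X ≐ₚ Y → SystemLeaf X p → SystemLeaf Y p
systemLeaf-≐ {p = τ , ρ} e (domLeaf , sectionLeaf) = leaf-≐ (dom-≐ e) domLeaf , leaf-≐ (section-≐ τ e) sectionLeaf

bigFin-from-≐ : ∀ {g h Q A X} (L : List Pair) → X ≐ₚ ⟦ L ⟧ → ForestSystem X A → SystemBushy g h X →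
  (∀ p → SystemLeaf X p → Q p) → BigFin g h Q A
bigFin-from-≐ {g = g} {h} L e system bushy leaves =
  L , system-≐ e system , systemBushy-≐ {g = g} {h} e bushy , λ p l → leaves p (systemLeaf-≐ (≐ₚ-sym e) l)

record FinSet (F : StrSet) : Set where
  field
    elements : List Str
    complete : ∀ x → F x → x ∈ elements
    decide : ∀ x → Dec (F x)
open FinSet

dec→ : ∀ {P Q : Set} → Dec P → Dec Q → Dec (P → Q)
dec→ (yes p) (yes q) = yes (λ _ → q)
dec→ (yes p) (no ¬q) = no (λ f → ¬q (f p))
dec→ (no ¬p) _ = yes (λ p → ⊥-elim (¬p p))

leaf? : ∀ {F} → FinSet F → ∀ x → Dec (IsLeaf F x)
leaf? {F} fin x with decide fin x | All.all? (λ y → dec→ (decide fin y) (dec→ (x ⪯? y) (y ≟ₛ x))) (elements fin)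
... | no ¬fx | _ = no (λ l → ¬fx (proj₁ l))
... | yes fx | yes maximal = yes (fx , λ y fy xy → All.lookup maximal (complete fin y fy) fy xy)
... | yes fx | no ¬maximal = no (λ (_ , maximal) → ¬maximal (All.tabulate (λ {y} _ fy xy → maximal y fy xy)))

dom? : ∀ (T : List Pair) τ → Dec (dom ⟦ T ⟧ τ)
dom? [] τ = no (λ { (ρ , ()) })
dom? ((a , b) ∷ T) τ with a ≟ₛ τ | dom? T τ
... | yes refl | _ = yes (b , here refl)
... | no _ | yes (ρ , m) = yes (ρ , there m)
... | no ne | no nd = no λ { (ρ , here eq) → ne (cong proj₁ (sym eq)) ; (ρ , there m) → nd (ρ , m) }

domFinite : ∀ T → FinSet (dom ⟦ T ⟧)
domFinite T = record { elements = map proj₁ T ; complete = λ x (ρ , m) → ∈-map⁺ proj₁ m ; decide = dom? T }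

sectionFinite : ∀ T τ → FinSet (section ⟦ T ⟧ τ)
sectionFinite T τ = record { elements = map proj₂ T ; complete = λ x m → ∈-map⁺ proj₂ m ; decide = λ ρ → (τ , ρ) ∈? T }

leaves : List Pair → Str → List Str
leaves T τ = filter (leaf? (sectionFinite T τ)) (map proj₂ T)

leaves⁺ : ∀ {T τ ρ} → IsLeaf (section ⟦ T ⟧ τ) ρ → ρ ∈ leaves T τ
leaves⁺ {T} {τ} l = ∈-filter⁺ (leaf? (sectionFinite T τ)) (∈-map⁺ proj₂ (proj₁ l)) l

leaves⁻ : ∀ {T τ ρ} → ρ ∈ leaves T τ → IsLeaf (section ⟦ T ⟧ τ) ρ
leaves⁻ {T} {τ} m = proj₂ (∈-filter⁻ (leaf? (sectionFinite T τ)) {xs = map proj₂ T} m)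

leaves-prefixFree : ∀ T τ → PrefixFree (_∈ leaves T τ)
leaves-prefixFree T τ ρ ρ' m m' le = sym (proj₂ (leaves⁻ {T} m) ρ' (proj₁ (leaves⁻ {T} m')) le)

pairsAt : Str → List Str → List Pair
pairsAt τ R = map (τ ,_) R

pairsAt-fst : ∀ {σ ρ τ R} → (σ , ρ) ∈ pairsAt τ R → σ ≡ τ
pairsAt-fst m with ∈-map⁻ (_ ,_) m
... | _ , _ , refl = refl

pairsAt-snd : ∀ {σ ρ τ R} → (σ , ρ) ∈ pairsAt τ R → ρ ∈ R
pairsAt-snd m with ∈-map⁻ (_ ,_) m
... | _ , m' , refl = m'

pairsAt-prefixFree : ∀ τ R → PrefixFree (_∈ R) → PrefixFreePairs ⟦ pairsAt τ R ⟧
pairsAt-prefixFree τ R pf =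
  (λ σ σ' (_ , m) (_ , m') _ → trans (pairsAt-fst m) (sym (pairsAt-fst m'))) ,
  λ _ ρ ρ' m m' le → pf ρ ρ' (pairsAt-snd m) (pairsAt-snd m') le

single-prefixFree : ∀ p → PrefixFreePairs ⟦ p ∷ [] ⟧
single-prefixFree p = (λ { σ σ' (_ , here refl) (_ , here refl) _ → refl }) ,
                      λ { τ ρ ρ' (here refl) (here refl) _ → refl }

leaf-unique : ∀ {F a b x} → IsLeaf F a → IsLeaf F b → a ⪯ x → b ⪯ x → a ≡ b
leaf-unique {a = a} {b} (fa , maxA) (fb , maxB) ax bx with ⪯-comparable ax bx
... | inj₁ ab = sym (maxA b fb ab)
... | inj₂ ba = maxB a fa ba

leaf-restrict : ∀ {F G : StrSet} {x} → IsLeaf G x → (∀ y → F y → G y) → F x → IsLeaf F x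
leaf-restrict (_ , maximal) F⊆G fx = fx , λ y fy xy → maximal y (F⊆G y fy) xy

prefixFree-leaf : ∀ {F} → PrefixFree F → ∀ {x} → F x → IsLeaf F x
prefixFree-leaf pf {x} fx = fx , λ y fy xy → sym (pf x y fx fy xy)

_∪_ : StrSet → StrSet → StrSet
(F ∪ G) x = F x ⊎ G x

forest-∪ : ∀ {F G R P : StrSet} → IsForestAbove F R → IsForestAbove G P → (∀ p → P p → F p) →
           IsForestAbove (F ∪ G) R
forest-∪ {F} {G} {R} {P} isF isG P⊆F =
  (λ { τ (inj₁ x) → forest-base isF x ;
       τ (inj₂ y) → let (p , pp , pτ) = forest-base isG y ; (r , rr , rp) = forest-base isF (P⊆F p pp) in
                    r , rr , ⪯-trans rp pτ }) ,
  λ r rr → let ((t , ft , rt) , _ , _) = proj₂ isF r rr in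
    (t , inj₁ ft , rt) , (λ τ (_ , rτ) → rτ) , λ τ τ' (x , rτ) le ln → closed rr x rτ le ln , ⪯-byLength rτ le ln
  where
  closed : ∀ {r τ τ'} → R r → (F ∪ G) τ → r ⪯ τ → τ' ⪯ τ → length r ≤ length τ' → (F ∪ G) τ'
  closed rr (inj₁ x) rτ le ln = inj₁ (forest-closed isF rr x rτ le ln)
  closed {τ' = τ'} rr (inj₂ y) rτ le ln with forest-base isG y
  ... | p , pp , pτ with length p ≤? length τ'
  ...   | yes lp = inj₂ (forest-closed isG pp y pτ le lp)
  ...   | no nlp = let τ'p = ⪯-byLength le pτ (≰⇒≥ nlp) in
                   inj₁ (forest-closed isF rr (P⊆F p pp) (⪯-trans (⪯-byLength rτ le ln) τ'p) τ'p ln)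

endExtends-∪ʳ : ∀ {F F' G : StrSet} → EndExtends F' F → (∀ ρ → G ρ → ∃ λ p → IsLeaf F' p × p ⪯ ρ) →
                (∀ x → Dec (F x)) → EndExtends (F' ∪ G) F
endExtends-∪ʳ {F} {F'} {G} (old , new) G-above F? =
  (λ ρ fρ → inj₁ (old ρ fρ)) ,
  λ { ρ (inj₁ x) nf → new ρ x nf ;
      ρ (inj₂ y) nf → let (p , lp , pρ) = G-above ρ y in below (F? p) lp pρ }
  where
  below : ∀ {p ρ} → Dec (F p) → IsLeaf F' p → p ⪯ ρ → ∃ λ l → IsLeaf F l × l ⪯ ρ
  below {p} (yes fp) lp pρ = p , leaf-restrict lp old fp , pρ
  below {p} (no nfp) lp pρ = let (l , ll , lp') = new p (proj₁ lp) nfp in l , ll , ⪯-trans lp' pρ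

endExtends-∪ : ∀ {F G G' : StrSet} → EndExtends G' G → (∀ ρ → G ρ → ∃ λ p → IsLeaf F p × p ⪯ ρ) →
               EndExtends (F ∪ G') (F ∪ G)
endExtends-∪ {F} {G} {G'} (old , new) G-above =
  (λ { ρ (inj₁ x) → inj₁ x ; ρ (inj₂ y) → inj₂ (old ρ y) }) ,
  λ { ρ (inj₁ x) nf → ⊥-elim (nf (inj₁ x)) ;
      ρ (inj₂ y) nf → let (l , (gl , maxl) , lρ) = new ρ y (λ g → nf (inj₂ g)) in
        l , (inj₂ gl , maximal gl maxl) , lρ }
  where
  maximal : ∀ {l} → G l → (∀ ρ → G ρ → l ⪯ ρ → ρ ≡ l) → ∀ ρ → (F ∪ G) ρ → l ⪯ ρ → ρ ≡ l
  maximal gl maxl ρ (inj₂ gρ) lρ = maxl ρ gρ lρ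
  maximal {l} gl maxl ρ (inj₁ fρ) lρ =
    let (p , (_ , maxp) , pl) = G-above l gl
        ρ≡p = maxp ρ fρ (⪯-trans pl lρ) in
    trans ρ≡p (⪯-antisym pl (subst (l ⪯_) ρ≡p lρ))

prefixFree-forest : ∀ {F} → PrefixFree F → IsForestAbove F F
prefixFree-forest {F} pfF =
  (λ τ fτ → τ , fτ , ⪯-refl τ) ,
  λ σ fσ → (σ , fσ , ⪯-refl σ) , (λ _ (_ , s) → s) ,
    λ τ τ' (fτ , στ) le ln →
      let σ≡τ = pfF σ τ fσ fτ στ
          στ' = ⪯-byLength στ le ln in
      subst F (⪯-antisym στ' (subst (τ' ⪯_) (sym σ≡τ) le)) fσ , στ'

prefixFree-bushy : ∀ {F h} → PrefixFree F → IsBushy h F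
prefixFree-bushy pfF τ fτ notLeaf = ⊥-elim (notLeaf (prefixFree-leaf pfF fτ))

module Identity (g h : ℕ → ℕ) (L : List Pair) (pf : PrefixFreePairs ⟦ L ⟧) where
  system : ForestSystem ⟦ L ⟧ ⟦ L ⟧
  system = prefixFree-forest (proj₁ pf) ,
    (λ τ σ dτ dσ le → subst (λ z → IsForestAbove (section ⟦ L ⟧ τ) (section ⟦ L ⟧ z))
                        (sym (proj₁ pf σ τ dσ dτ le)) (prefixFree-forest (proj₂ pf τ))) ,
    λ τ τ' dτ dτ' (le , ne) → ⊥-elim (ne (proj₁ pf τ τ' dτ dτ' le))

  bushy : SystemBushy g h ⟦ L ⟧
  bushy = prefixFree-bushy {h = g} (proj₁ pf) , λ τ _ → prefixFree-bushy {h = h} (proj₂ pf τ)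

  leaf : ∀ {p} → p ∈ L → SystemLeaf ⟦ L ⟧ p
  leaf {τ , ρ} m = prefixFree-leaf (proj₁ pf) (ρ , m) , prefixFree-leaf (proj₂ pf τ) m

Successors : (ℕ → ℕ) → StrSet → Str → Set
Successors k F τ = ∃ λ (ns : List ℕ) → Unique ns × k (length τ) ≤ length ns × All (λ n → F (τ ∷ʳ n)) ns

successors-mono : ∀ {k F G τ} → (∀ x → F x → G x) → Successors k F τ → Successors k G τ
successors-mono F⊆G (ns , unique , enough , succs) = ns , unique , enough , All.map (F⊆G _) succs

bushy-or-leaf : ∀ {k F} → FinSet F → IsBushy k F → ∀ τ → Successors k F τ ⊎ (F τ → IsLeaf F τ)
bushy-or-leaf fin bushy τ with decide fin τ
... | no τ∉F = inj₂ (λ τ∈F → ⊥-elim (τ∉F τ∈F))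
... | yes τ∈F with leaf? fin τ
...   | yes leaf = inj₂ (λ _ → leaf)
...   | no notLeaf = inj₁ (bushy τ τ∈F notLeaf)

-- The glued system
-- consists of T, all S τ, and the pairs (τ' , ρ) with τ' ∈ dom (S τ) and
-- (τ , ρ) ∈ T; so at a node τ' of dom (S τ) its section is T(τ) ∪ S τ(τ').
module Concatenation (g h : ℕ → ℕ) (A : PairSet) (pfA : PrefixFree (dom A))
  (T : List Pair) (T-system : ForestSystem ⟦ T ⟧ A) (T-bushy : SystemBushy g h ⟦ T ⟧)
  (P : Str → List Str) (S : Str → List Pair)
  (P-leaves : ∀ {τ ρ} → IsLeaf (dom ⟦ T ⟧) τ → ρ ∈ P τ → IsLeaf (section ⟦ T ⟧ τ) ρ)
  (S-system : ∀ {τ} → IsLeaf (dom ⟦ T ⟧) τ → ForestSystem ⟦ S τ ⟧ ⟦ pairsAt τ (P τ) ⟧)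
  (S-bushy : ∀ {τ} → IsLeaf (dom ⟦ T ⟧) τ → SystemBushy g h ⟦ S τ ⟧) where

  domT : StrSet
  domT = dom ⟦ T ⟧

  secT : Str → StrSet
  secT = section ⟦ T ⟧

  domS : Str → StrSet
  domS τ = dom ⟦ S τ ⟧

  secS : Str → Str → StrSet
  secS τ = section ⟦ S τ ⟧

  base : Str → StrSet
  base τ = section ⟦ pairsAt τ (P τ) ⟧ τ

  base-leaf : ∀ {τ ρ} → IsLeaf domT τ → base τ ρ → IsLeaf (secT τ) ρ
  base-leaf lf m = P-leaves lf (pairsAt-snd m)

  Glued : PairSet
  Glued (τ' , ρ') = ⟦ T ⟧ (τ' , ρ') ⊎
     Σ Str λ τ → IsLeaf domT τ × (⟦ S τ ⟧ (τ' , ρ') ⊎ (domS τ τ' × ⟦ T ⟧ (τ , ρ')))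

  Glued-T : ∀ {τ} → domT τ → dom Glued τ
  Glued-T (ρ , t) = ρ , inj₁ t

  Glued-S : ∀ {τ τ'} → IsLeaf domT τ → domS τ τ' → dom Glued τ'
  Glued-S {τ} lf (ρ , s) = ρ , inj₂ (τ , lf , inj₁ s)

  S-root : ∀ {τ ρ} → IsLeaf domT τ → base τ ρ → domS τ τ
  S-root lf m = forest-root (system-dom (S-system lf)) (_ , m)

  module _ {τ τ'} (lf : IsLeaf domT τ) (sd : domS τ τ') where
    private
      below : ∃ λ σ → dom ⟦ pairsAt τ (P τ) ⟧ σ × σ ⪯ τ'
      below = forest-base (system-dom (S-system lf)) sd

    S-above : τ ⪯ τ'
    S-above with below
    ... | σ , (ρ , m) , le = subst (_⪯ τ') (pairsAt-fst m) le

    base-nonempty : ∃ λ ρ → base τ ρ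
    base-nonempty with below
    ... | σ , (ρ , m) , le = ρ , subst (λ z → (z , ρ) ∈ pairsAt τ (P τ)) (pairsAt-fst m) m

    S-closed : ∀ {τ''} → τ ⪯ τ'' → τ'' ⪯ τ' → domS τ τ''
    S-closed a b = forest-closed (system-dom (S-system lf)) base-nonempty sd S-above b (⪯-length a)

    S-section : IsForestAbove (secS τ τ') (base τ)
    S-section = system-section (S-system lf) sd base-nonempty S-above

    S-aboveLeaves : ∀ ρ → secS τ τ' ρ → ∃ λ p → IsLeaf (secT τ) p × p ⪯ ρ
    S-aboveLeaves ρ s = let (p , bp , pρ) = forest-base S-section s in p , base-leaf lf bp , pρ

    S-below-T : ∀ {ρ ρ''} → secS τ τ' ρ → secT τ ρ'' → ρ ⪯ ρ'' → ρ'' ≡ ρ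
    S-below-T {ρ} {ρ''} s t'' le =
      let (p , (_ , maxp) , pρ) = S-aboveLeaves ρ s
          ρ''≡p = maxp ρ'' t'' (⪯-trans pρ le) in
      trans ρ''≡p (⪯-antisym pρ (subst (ρ ⪯_) ρ''≡p le))

    leaf-below-S : ∀ {ρ ρ''} → IsLeaf (secT τ) ρ → secS τ τ' ρ'' → ρ ⪯ ρ'' → secS τ τ' ρ
    leaf-below-S leafT s'' le =
      let (p , bp , pρ'') = forest-base S-section s'' in
      subst (secS τ τ') (sym (leaf-unique leafT (base-leaf lf bp) le pρ'')) (forest-root S-section bp)

  data Position (τ' : Str) : Set where
    inT : domT τ' → (∀ τ → IsLeaf domT τ → τ ⪯ τ' → ¬ domS τ τ') → Position τ'
    inS : ∀ τ → IsLeaf domT τ → τ ⪯ τ' → domS τ τ' → Position τ'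

  position : ∀ τ' → dom Glued τ' → Position τ'
  position τ' (ρ , inj₂ (τ , lf , inj₁ s)) = inS τ lf (S-above lf (ρ , s)) (ρ , s)
  position τ' (ρ , inj₂ (τ , lf , inj₂ (sd , t))) = inS τ lf (S-above lf sd) sd
  position τ' (ρ , inj₁ t) with leaf? (domFinite T) τ'
  ... | no nl = inT (ρ , t) λ τ lf le _ → nl (subst (IsLeaf domT) (sym (proj₂ lf τ' (ρ , t) le)) lf)
  ... | yes lf' with decide (domFinite (S τ')) τ'
  ...   | yes sd = inS τ' lf' (⪯-refl τ') sd
  ...   | no nsd = inT (ρ , t) λ τ lf le sd → nsd (subst (λ z → domS z τ') (sym (proj₂ lf τ' (ρ , t) le)) sd)

  section-inT : ∀ {τ'} → (∀ τ → IsLeaf domT τ → τ ⪯ τ' → ¬ domS τ τ') → section Glued τ' ≐ secT τ'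
  section-inT n =
    (λ { ρ (inj₁ t) → t ;
         ρ (inj₂ (τ , lf , inj₁ s)) → ⊥-elim (n τ lf (S-above lf (ρ , s)) (ρ , s)) ;
         ρ (inj₂ (τ , lf , inj₂ (sd , _))) → ⊥-elim (n τ lf (S-above lf sd) sd) }) ,
    (λ ρ t → inj₁ t)

  joined : Str → Str → StrSet
  joined τ τ' = secT τ ∪ secS τ τ'

  section-inS : ∀ {τ τ'} → IsLeaf domT τ → τ ⪯ τ' → domS τ τ' → section Glued τ' ≐ joined τ τ'
  section-inS {τ} {τ'} lf le sd =
    (λ { ρ (inj₁ t) → inj₁ (subst (λ z → secT z ρ) (proj₂ lf τ' (ρ , t) le) t) ;
         ρ (inj₂ (τ₂ , lf₂ , inj₁ s)) → inj₂ (subst (λ z → secS z τ' ρ) (leaf-unique lf₂ lf (S-above lf₂ (ρ , s)) le) s) ;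
         ρ (inj₂ (τ₂ , lf₂ , inj₂ (sd₂ , t))) → inj₁ (subst (λ z → secT z ρ) (leaf-unique lf₂ lf (S-above lf₂ sd₂) le) t) }) ,
    (λ { ρ (inj₁ t) → inj₂ (τ , lf , inj₂ (sd , t)) ;
         ρ (inj₂ s) → inj₂ (τ , lf , inj₁ s) })

  dom-base : ∀ τ' → Position τ' → ∃ λ σ → dom A σ × σ ⪯ τ'
  dom-base τ' (inT d _) = forest-base (system-dom T-system) d
  dom-base τ' (inS τ lf le sd) =
    let (σ , dσ , στ) = forest-base (system-dom T-system) (proj₁ lf) in σ , dσ , ⪯-trans στ le

  dom-closed : ∀ {σ τ' τ''} → dom A σ → Position τ' → σ ⪯ τ' → τ'' ⪯ τ' → length σ ≤ length τ'' → dom Glued τ''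
  dom-closed dσ (inT d _) στ' le ln = Glued-T (forest-closed (system-dom T-system) dσ d στ' le ln)
  dom-closed {τ'' = τ''} dσ (inS τ lf lτ sd) στ' le ln with length τ ≤? length τ''
  ... | yes l = Glued-S lf (S-closed lf sd (⪯-byLength lτ le l) le)
  ... | no nl = let τ''τ = ⪯-byLength le lτ (≰⇒≥ nl) in
    Glued-T (forest-closed (system-dom T-system) dσ (proj₁ lf) (⪯-trans (⪯-byLength στ' le ln) τ''τ) τ''τ ln)

  dom-forest : IsForestAbove (dom Glued) (dom A)
  dom-forest =
    (λ τ' dx → dom-base τ' (position τ' dx)) ,
    λ σ dσ → let ((t , dt , σt) , _ , _) = proj₂ (system-dom T-system) σ dσ in
      (t , Glued-T dt , σt) , (λ _ (_ , s) → s) ,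
      λ τ' τ'' (dx , στ') le ln → dom-closed dσ (position τ' dx) στ' le ln , ⪯-byLength στ' le ln

  section-forest : ∀ τ' σ → Position τ' → dom A σ → σ ⪯ τ' → IsForestAbove (section Glued τ') (section A σ)
  section-forest τ' σ (inT d n) dσ le = forest-≐ (≐-sym (section-inT n)) (system-section T-system d dσ le)
  section-forest τ' σ (inS τ lf lτ sd) dσ le =
    forest-≐ (≐-sym (section-inS lf lτ sd))
      (forest-∪ (system-section T-system (proj₁ lf) dσ στ) (S-section lf sd) (λ ρ m → proj₁ (base-leaf lf m)))
    where
    -- σ is the element of dom A below τ, as dom A is prefix-free.
    στ : σ ⪯ τ
    στ with forest-base (system-dom T-system) (proj₁ lf)
    ... | σ₀ , dσ₀ , σ₀τ with ⪯-comparable (⪯-trans σ₀τ lτ) le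
    ...   | inj₁ a = subst (_⪯ τ) (pfA σ₀ σ dσ₀ dσ a) σ₀τ
    ...   | inj₂ b = subst (_⪯ τ) (sym (pfA σ σ₀ dσ dσ₀ b)) σ₀τ

  endExtends : ∀ τ₁ τ₂ → Position τ₁ → Position τ₂ → τ₁ ≺ τ₂ → EndExtends (section Glued τ₂) (section Glued τ₁)
  endExtends τ₁ τ₂ (inT d₁ n₁) (inT d₂ n₂) lt =
    endExtends-≐ (≐-sym (section-inT n₁)) (≐-sym (section-inT n₂)) (system-endExtends T-system d₁ d₂ lt)
  endExtends τ₁ τ₂ (inT d₁ n₁) (inS τ lf lτ sd) (le , ne) with τ₁ ≟ₛ τ
  ... | yes refl = ⊥-elim (n₁ τ₁ lf (⪯-refl τ₁) (S-root lf (proj₂ (base-nonempty lf sd))))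
  ... | no τ₁≢τ with ⪯-comparable lτ le
  ...   | inj₁ ττ₁ = ⊥-elim (τ₁≢τ (proj₂ lf τ₁ d₁ ττ₁))
  ...   | inj₂ τ₁τ = endExtends-≐ (≐-sym (section-inT n₁)) (≐-sym (section-inS lf lτ sd))
            (endExtends-∪ʳ (system-endExtends T-system d₁ (proj₁ lf) (τ₁τ , τ₁≢τ)) (S-aboveLeaves lf sd)
              (decide (sectionFinite T τ₁)))
  endExtends τ₁ τ₂ (inS τ lf lτ sd) (inT d₂ n₂) (le , ne) =
    let τ₂≡τ = proj₂ lf τ₂ d₂ (⪯-trans lτ le) in
    ⊥-elim (ne (⪯-antisym le (subst (_⪯ τ₁) (sym τ₂≡τ) lτ)))
  endExtends τ₁ τ₂ (inS τa lfa la sda) (inS τb lfb lb sdb) (le , ne) with leaf-unique lfa lfb (⪯-trans la le) lb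
  ... | refl = endExtends-≐ (≐-sym (section-inS lfa la sda)) (≐-sym (section-inS lfb lb sdb))
                 (endExtends-∪ (system-endExtends (S-system lfa) sda sdb (le , ne)) (S-aboveLeaves lfa sda))

  Glued-system : ForestSystem Glued A
  Glued-system =
    dom-forest ,
    (λ τ' σ dx → section-forest τ' σ (position τ' dx)) ,
    λ τ₁ τ₂ d₁ d₂ → endExtends τ₁ τ₂ (position τ₁ d₁) (position τ₂ d₂)

  -- dom Glued is g-bushy: a non-leaf of dom Glued is a non-leaf of dom T or
  -- of some dom (S τ).
  dom-bushy : ∀ τ' → Position τ' → dom Glued τ' → ¬ IsLeaf (dom Glued) τ' → Successors g (dom Glued) τ'
  dom-bushy τ' (inT d n) dx notLeaf with bushy-or-leaf {k = g} (domFinite T) (proj₁ T-bushy) τ'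
  ... | inj₁ succ = successors-mono {k = g} {τ = τ'} (λ x → Glued-T {x}) succ
  ... | inj₂ leafT = ⊥-elim (notLeaf (dx , λ τ'' dx'' le → maximal τ'' (position τ'' dx'') le))
    where
    lf = leafT d
    maximal : ∀ τ'' → Position τ'' → τ' ⪯ τ'' → τ'' ≡ τ'
    maximal τ'' (inT d'' _) le = proj₂ lf τ'' d'' le
    maximal τ'' (inS τ lf' lτ sd) le =
      let sd' = subst (λ z → domS z τ'') (sym (leaf-unique lf lf' le lτ)) sd in
      ⊥-elim (n τ' lf (⪯-refl τ') (S-closed lf sd' (⪯-refl τ') le))
  dom-bushy τ' (inS τ lf lτ sd) dx notLeaf with bushy-or-leaf {k = g} (domFinite (S τ)) (proj₁ (S-bushy lf)) τ'
  ... | inj₁ succ = successors-mono {k = g} {τ = τ'} (λ x → Glued-S {τ' = x} lf) succ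
  ... | inj₂ leafS = ⊥-elim (notLeaf (dx , λ τ'' dx'' le → maximal τ'' (position τ'' dx'') le))
    where
    maximal : ∀ τ'' → Position τ'' → τ' ⪯ τ'' → τ'' ≡ τ'
    maximal τ'' (inT d'' _) le =
      let τ''≡τ = proj₂ lf τ'' d'' (⪯-trans lτ le) in ⪯-antisym (subst (_⪯ τ') (sym τ''≡τ) lτ) le
    maximal τ'' (inS τ₂ lf₂ lτ₂ sd₂) le =
      let τ₂≡τ = leaf-unique lf₂ lf lτ₂ (⪯-trans lτ le) in
      proj₂ (leafS sd) τ'' (subst (λ z → domS z τ'') τ₂≡τ sd₂) le

  -- T(τ) ∪ S τ(τ') is h-bushy: a string that is not a leaf of it fails to be
  -- a leaf of T(τ) or of S τ(τ').
  joined-leaf : ∀ {τ τ' ρ} (lf : IsLeaf domT τ) (sd : domS τ τ') → joined τ τ' ρ →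
    (secT τ ρ → IsLeaf (secT τ) ρ) → (secS τ τ' ρ → IsLeaf (secS τ τ') ρ) → IsLeaf (joined τ τ') ρ
  joined-leaf {τ} {τ'} {ρ} lf sd uρ leafT leafS = uρ , maximal uρ
    where
    maximal : joined τ τ' ρ → ∀ ρ'' → joined τ τ' ρ'' → ρ ⪯ ρ'' → ρ'' ≡ ρ
    maximal (inj₁ t) ρ'' (inj₁ t'') le = proj₂ (leafT t) ρ'' t'' le
    maximal (inj₂ s) ρ'' (inj₁ t'') le = S-below-T lf sd s t'' le
    maximal (inj₁ t) ρ'' (inj₂ s'') le = proj₂ (leafS (leaf-below-S lf sd (leafT t) s'' le)) ρ'' s'' le
    maximal (inj₂ s) ρ'' (inj₂ s'') le = proj₂ (leafS s) ρ'' s'' le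

  joined-bushy : ∀ {τ τ'} → IsLeaf domT τ → domS τ τ' → IsBushy h (joined τ τ')
  joined-bushy {τ} {τ'} lf sd ρ uρ notLeaf
    with bushy-or-leaf {k = h} (sectionFinite T τ) (proj₂ T-bushy τ (proj₁ lf)) ρ
       | bushy-or-leaf {k = h} (sectionFinite (S τ) τ') (proj₂ (S-bushy lf) τ' sd) ρ
  ... | inj₁ succ | _ = successors-mono {k = h} {F = secT τ} {G = joined τ τ'} {τ = ρ} (λ _ → inj₁) succ
  ... | inj₂ _ | inj₁ succ = successors-mono {k = h} {F = secS τ τ'} {G = joined τ τ'} {τ = ρ} (λ _ → inj₂) succ
  ... | inj₂ leafT | inj₂ leafS = ⊥-elim (notLeaf (joined-leaf lf sd uρ leafT leafS))

  section-bushy : ∀ τ' → Position τ' → IsBushy h (section Glued τ')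
  section-bushy τ' (inT d n) = bushy-≐ {h = h} (≐-sym (section-inT n)) (proj₂ T-bushy τ' d)
  section-bushy τ' (inS τ lf lτ sd) = bushy-≐ {h = h} (≐-sym (section-inS lf lτ sd)) (joined-bushy lf sd)

  Glued-bushy : SystemBushy g h Glued
  Glued-bushy = (λ τ' dx → dom-bushy τ' (position τ' dx) dx) , λ τ' dx → section-bushy τ' (position τ' dx)

  GluedLeaf : PairSet
  GluedLeaf (τ' , ρ') = Σ Str λ τ → IsLeaf domT τ × τ ⪯ τ' ×
    (SystemLeaf ⟦ S τ ⟧ (τ' , ρ') ⊎ (IsLeaf (secT τ) ρ' × ¬ base τ ρ'))

  leaf-shape : ∀ τ' ρ' → Position τ' → SystemLeaf Glued (τ' , ρ') → GluedLeaf (τ' , ρ')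
  leaf-shape τ' ρ' (inT d n) (domLeaf , sectionLeaf) =
    let lf = leaf-restrict domLeaf (λ _ → Glued-T) d in
    τ' , lf , ⪯-refl τ' , inj₂ (leaf-≐ (section-inT n) sectionLeaf , λ b → n τ' lf (⪯-refl τ') (S-root lf b))
  leaf-shape τ' ρ' (inS τ lf lτ sd) (domLeaf , sectionLeaf) with decide (sectionFinite (S τ) τ') ρ'
  ... | yes s = τ , lf , lτ , inj₁ (leaf-restrict domLeaf (λ _ → Glued-S lf) sd , leaf-restrict joinedLeaf (λ _ → inj₂) s)
    where joinedLeaf = leaf-≐ (section-inS lf lτ sd) sectionLeaf
  ... | no ns with leaf-≐ (section-inS lf lτ sd) sectionLeaf
  ...   | (inj₂ s , _) = ⊥-elim (ns s)
  ...   | joinedLeaf@(inj₁ t , _) =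
          τ , lf , lτ , inj₂ (leaf-restrict joinedLeaf (λ _ → inj₁) t , λ b → ns (forest-root (S-section lf sd) b))

  when : ∀ {Q : Set} → Dec Q → List Pair → List Pair
  when (yes _) l = l
  when (no _) l = []

  when⁺ : ∀ {Q : Set} {p l} (d : Dec Q) → Q → p ∈ l → p ∈ when d l
  when⁺ (yes _) q m = m
  when⁺ (no nq) q m = ⊥-elim (nq q)

  when⁻ : ∀ {Q : Set} {p l} (d : Dec Q) → p ∈ when d l → Q × p ∈ l
  when⁻ (yes q) m = q , m
  when⁻ (no nq) ()

  copy : Str → Str → Pair → List Pair
  copy τ τ' (a , b) = when (a ≟ₛ τ) ((τ' , b) ∷ [])

  copies : Str → List Pair
  copies τ = concatMap (λ τ' → concatMap (copy τ τ') T) (map proj₁ (S τ))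

  copies⁺ : ∀ {τ τ' ρ} → domS τ τ' → (τ , ρ) ∈ T → (τ' , ρ) ∈ copies τ
  copies⁺ {τ} {τ'} {ρ} (_ , s) t =
    ∈-concatMap⁺ (λ τ'' → concatMap (copy τ τ'') T)
      (lose (∈-map⁺ proj₁ s) (∈-concatMap⁺ (copy τ τ') (lose t (when⁺ (τ ≟ₛ τ) refl (here refl)))))

  copies⁻ : ∀ {τ τ' ρ} → (τ' , ρ) ∈ copies τ → domS τ τ' × (τ , ρ) ∈ T
  copies⁻ {τ} m with find (∈-concatMap⁻ (λ τ'' → concatMap (copy τ τ'') T) {xs = map proj₁ (S τ)} m)
  ... | τ' , m₁ , m₂ with ∈-map⁻ proj₁ m₁ | find (∈-concatMap⁻ (copy τ τ') {xs = T} m₂)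
  ...   | q , qm , refl | (a , b) , abm , pm with when⁻ (a ≟ₛ τ) pm
  ...     | refl , here refl = (proj₂ q , qm) , abm

  extension : Str → List Pair
  extension τ = when (leaf? (domFinite T) τ) (S τ ++ copies τ)

  gluedList : List Pair
  gluedList = T ++ concatMap extension (map proj₁ T)

  Glued→list : ∀ p → Glued p → p ∈ gluedList
  Glued→list p (inj₁ t) = ∈-++⁺ˡ t
  Glued→list (τ' , ρ') (inj₂ (τ , lf , p∈)) =
    ∈-++⁺ʳ T (∈-concatMap⁺ extension (lose (∈-map⁺ proj₁ (proj₂ (proj₁ lf))) (when⁺ (leaf? (domFinite T) τ) lf (inExtension p∈))))
    where
    inExtension : ⟦ S τ ⟧ (τ' , ρ') ⊎ (domS τ τ' × ⟦ T ⟧ (τ , ρ')) → (τ' , ρ') ∈ S τ ++ copies τ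
    inExtension (inj₁ s) = ∈-++⁺ˡ s
    inExtension (inj₂ (sd , t)) = ∈-++⁺ʳ (S τ) (copies⁺ sd t)

  list→Glued : ∀ p → p ∈ gluedList → Glued p
  list→Glued p m with ∈-++⁻ T m
  ... | inj₁ t = inj₁ t
  ... | inj₂ m' with find (∈-concatMap⁻ extension {xs = map proj₁ T} m')
  ...   | τ , _ , me with when⁻ (leaf? (domFinite T) τ) me
  ...     | lf , me' with ∈-++⁻ (S τ) me'
  ...       | inj₁ s = inj₂ (τ , lf , inj₁ s)
  ...       | inj₂ c = inj₂ (τ , lf , inj₂ (copies⁻ c))

  concatenation : BigFin g h GluedLeaf A
  concatenation = bigFin-from-≐ {g = g} {h} gluedList (Glued→list , list→Glued) Glued-system Glued-bushy
    λ { (τ' , ρ') leaf → leaf-shape τ' ρ' (position τ' (proj₁ (proj₁ leaf))) leaf }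

module Extension (g h : ℕ → ℕ) (C : PairSet) (C-open : IsOpen C) where

  -- If, at every leaf τ of dom T, C is big above the pairs (τ , ρ) with ρ a
  -- leaf of T(τ), then C is big above A: concatenate those systems onto T.
  big-from-leaves : (A : PairSet) → PrefixFree (dom A) → (T : List Pair) → ForestSystem ⟦ T ⟧ A →
    SystemBushy g h ⟦ T ⟧ → (∀ τ → IsLeaf (dom ⟦ T ⟧) τ → BigFin g h C ⟦ pairsAt τ (leaves T τ) ⟧) →
    BigFin g h C A
  big-from-leaves A pfA T T-system T-bushy big-at = BigFin-mono {g = g} {h} in-C Glue.concatenation
    where
    chosen : ∀ τ → Dec (IsLeaf (dom ⟦ T ⟧) τ) → List Pair
    chosen τ (yes lf) = proj₁ (big-at τ lf)
    chosen τ (no _) = []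

    S : Str → List Pair
    S τ = chosen τ (leaf? (domFinite T) τ)

    chosen-big : ∀ τ (d : Dec (IsLeaf (dom ⟦ T ⟧) τ)) → IsLeaf (dom ⟦ T ⟧) τ →
      ForestSystem ⟦ chosen τ d ⟧ ⟦ pairsAt τ (leaves T τ) ⟧ × SystemBushy g h ⟦ chosen τ d ⟧ ×
      (∀ p → SystemLeaf ⟦ chosen τ d ⟧ p → C p)
    chosen-big τ (yes lf) _ = proj₂ (big-at τ lf)
    chosen-big τ (no nl) lf = ⊥-elim (nl lf)

    S-big : ∀ {τ} → IsLeaf (dom ⟦ T ⟧) τ →
      ForestSystem ⟦ S τ ⟧ ⟦ pairsAt τ (leaves T τ) ⟧ × SystemBushy g h ⟦ S τ ⟧ × (∀ p → SystemLeaf ⟦ S τ ⟧ p → C p)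
    S-big {τ} = chosen-big τ (leaf? (domFinite T) τ)

    module Glue = Concatenation g h A pfA T T-system T-bushy (leaves T) S (λ _ → leaves⁻ {T})
                    (λ lf → proj₁ (S-big lf)) (λ lf → proj₁ (proj₂ (S-big lf)))

    -- Every leaf of T(τ) is in P τ, so all leaves of the glued system are
    -- leaves of the chosen systems.
    in-C : ∀ p → Glue.GluedLeaf p → C p
    in-C p (τ , lf , _ , inj₁ leaf) = proj₂ (proj₂ (S-big lf)) p leaf
    in-C (_ , ρ) (τ , lf , _ , inj₂ (leaf , ∉P)) = ⊥-elim (∉P (∈-map⁺ (τ ,_) (leaves⁺ leaf)))

  Good : Pair → Set
  Good (τ , ρ) = ∀ τ' → τ ⪯ τ' → Big g h C (single (τ' , ρ))

  -- During the induction a pair is in C already, or still pending and good.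
  Handled : List Str → Pair → Set
  Handled pending (τ , ρ) = C (τ , ρ) ⊎ (ρ ∈ pending × Good (τ , ρ))

  handled-extend : ∀ {pending τ τ' ρ} → τ ⪯ τ' → Handled pending (τ , ρ) → Handled pending (τ' , ρ)
  handled-extend {ρ = ρ} le (inj₁ c) = inj₁ (C-open _ _ c (le , ⪯-refl ρ))
  handled-extend le (inj₂ (m , good)) = inj₂ (m , λ τ'' le' → good τ'' (⪯-trans le le'))

  handled-drop : ∀ {b pending τ ρ} → (ρ ≡ b → C (τ , ρ)) → Handled (b ∷ pending) (τ , ρ) → Handled pending (τ , ρ)
  handled-drop b-done (inj₁ c) = inj₁ c
  handled-drop b-done (inj₂ (here refl , _)) = inj₁ (b-done refl)
  handled-drop b-done (inj₂ (there m , good)) = inj₂ (m , good)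

  -- By induction on the
  -- pending list: the first pending b ∈ R not yet in C is good, so C is big
  -- above (τ , b); concatenating that system onto {τ} × R, every new leaf is
  -- in C or is (τ' , ρ) with τ ⪯ τ' and ρ ∈ R handled with b dropped.
  big-at-node : ∀ pending τ (R : List Str) → PrefixFree (_∈ R) →
    (∀ ρ → ρ ∈ R → Handled pending (τ , ρ)) → BigFin g h C ⟦ pairsAt τ R ⟧
  big-at-node [] τ R pf handled =
    pairsAt τ R , Identity.system g h _ pfR , Identity.bushy g h _ pfR ,
    λ { (τ' , ρ) leaf → in-C (proj₁ (proj₂ leaf)) }
    where
    pfR = pairsAt-prefixFree τ R pf
    in-C : ∀ {τ' ρ} → (τ' , ρ) ∈ pairsAt τ R → C (τ' , ρ)
    in-C {ρ = ρ} m with pairsAt-fst m | handled ρ (pairsAt-snd m)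
    ... | refl | inj₁ c = c
  big-at-node (b ∷ pending) τ R pf handled with b Strings.∈? R
  ... | no b∉R = big-at-node pending τ R pf λ ρ m → handled-drop (λ { refl → ⊥-elim (b∉R m) }) (handled ρ m)
  ... | yes b∈R with handled b b∈R
  ...   | inj₁ c = big-at-node pending τ R pf λ ρ m → handled-drop (λ { refl → c }) (handled ρ m)
  ...   | inj₂ (_ , good) = big-from-leaves ⟦ pairsAt τ R ⟧ (proj₁ pfR) T₁ T₁-system T₁-bushy recurse
    where
    pfR = pairsAt-prefixFree τ R pf
    big-b : BigFin g h C ⟦ (τ , b) ∷ [] ⟧
    big-b = good τ (⪯-refl τ) ((τ , b) ∷ []) (λ { _ (here refl) → refl }) (single-prefixFree (τ , b))

    leaf≡τ : ∀ {τ'} → IsLeaf (dom ⟦ pairsAt τ R ⟧) τ' → τ' ≡ τ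
    leaf≡τ lf = pairsAt-fst (proj₂ (proj₁ lf))

    b-leaf : ∀ {τ' ρ} → IsLeaf (dom ⟦ pairsAt τ R ⟧) τ' → ρ ∈ b ∷ [] → IsLeaf (section ⟦ pairsAt τ R ⟧ τ') ρ
    b-leaf lf (here refl) rewrite leaf≡τ lf = proj₂ (Identity.leaf g h _ pfR (∈-map⁺ (τ ,_) b∈R))

    b-system : ∀ {τ'} → IsLeaf (dom ⟦ pairsAt τ R ⟧) τ' → ForestSystem ⟦ proj₁ big-b ⟧ ⟦ pairsAt τ' (b ∷ []) ⟧
    b-system lf rewrite leaf≡τ lf = proj₁ (proj₂ big-b)

    module Step = Concatenation g h ⟦ pairsAt τ R ⟧ (proj₁ pfR) (pairsAt τ R)
                    (Identity.system g h _ pfR) (Identity.bushy g h _ pfR)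
                    (λ _ → b ∷ []) (λ _ → proj₁ big-b) b-leaf b-system (λ _ → proj₁ (proj₂ (proj₂ big-b)))

    T₁ = proj₁ Step.concatenation
    T₁-system = proj₁ (proj₂ Step.concatenation)
    T₁-bushy = proj₁ (proj₂ (proj₂ Step.concatenation))

    step-leaf : ∀ {τ' ρ} → Step.GluedLeaf (τ' , ρ) → Handled pending (τ' , ρ)
    step-leaf {τ'} {ρ} (_ , _ , _ , inj₁ leaf) = inj₁ (proj₂ (proj₂ (proj₂ big-b)) (τ' , ρ) leaf)
    step-leaf {τ'} {ρ} (τ₀ , lf , τ₀⪯τ' , inj₂ (leaf , ∉b)) with leaf≡τ lf
    ... | refl = handled-extend τ₀⪯τ'
                   (handled-drop (λ { refl → ⊥-elim (∉b (here refl)) }) (handled ρ (pairsAt-snd (proj₁ leaf))))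

    recurse : ∀ τ' → IsLeaf (dom ⟦ T₁ ⟧) τ' → BigFin g h C ⟦ pairsAt τ' (leaves T₁ τ') ⟧
    recurse τ' lf = big-at-node pending τ' (leaves T₁ τ') (leaves-prefixFree T₁ τ')
      λ ρ m → step-leaf (proj₂ (proj₂ (proj₂ Step.concatenation)) (τ' , ρ) (lf , leaves⁻ {T₁} m))

  big-from-good-leaves : (A : PairSet) → PrefixFree (dom A) → (T : List Pair) → ForestSystem ⟦ T ⟧ A →
    SystemBushy g h ⟦ T ⟧ → (∀ p → SystemLeaf ⟦ T ⟧ p → Good p) → BigFin g h C A
  big-from-good-leaves A pfA T T-system T-bushy good =
    big-from-leaves A pfA T T-system T-bushy λ τ lf →
      big-at-node (leaves T τ) τ (leaves T τ) (leaves-prefixFree T τ)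
        λ ρ m → inj₂ (m , good (τ , ρ) (lf , leaves⁻ {T} m))

corollary3p13 : (A B C : PairSet) (g h : ℕ → ℕ) → IsBounding g → IsBounding h →
    IsOpen C → Big g h B A →
    (∀ τ ρ τ' → B (τ , ρ) → τ ⪯ τ' → Big g h C (single (τ' , ρ))) →
    Big g h C A
corollary3p13 A B C g h _ _ C-open B-big C-big L L⊆A pfL =
  let (T , T-system , T-bushy , leaves-in-B) = B-big L L⊆A pfL in
  Extension.big-from-good-leaves g h C C-open ⟦ L ⟧ (proj₁ pfL) T T-system T-bushy
    λ { (τ , ρ) leaf τ' τ⪯τ' → C-big τ ρ τ' (leaves-in-B (τ , ρ) leaf) τ⪯τ' }
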